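{- Let $n,r$ be positive integers with $r\geq 3$. If $\chi$ is a palindromic Gallai-Schur $r$-coloring of $[1,n]$, then $$\chi^{+}=\langle \chi, r+1, \chi, r+1, \chi, r+2, \chi, r+1, \chi, r+2,\chi, r+2,\chi, r+2, \chi, r+1, \chi\rangle$$ is a strict Gallai-Schur $(r+2)$-coloring of $[1,9n+8]$, i.e., an $(r+2)$-coloring of $[1,9n+8]$ admitting no strict Gallai-Schur triple.
   Context: $[1,n]=\{1,\dots,n\}$. An $r$-coloring of $[1,n]$ is a function $\chi:[1,n]\to\{1,\dots,r\}$. Under $\chi$, a Gallai-Schur triple is a triple $(x,y,z)$ with $x,y,z\in[1,n]$, $x\leq y$, $x+y=z$, and either $\chi(x)=\chi(y)=\chi(z)$ or $\chi(x),\chi(y),\chi(z)$ pairwise distinct; it is strict if $x<y$. $\chi$ is a Gallai-Schur coloring if it has no Gallai-Schur triple, and palindromic if $\chi(i)=\chi(n+1-i)$ for all $i\in[1,n]$. For a coloring $\chi$ of $[1,n]$ and colors $c_1,\dots,c_m$, the concatenation $\langle \chi,c_1,\chi,c_2,\dots,c_m,\chi\rangle$ is the coloring $\psi$ of $[1,(m+1)n+m]$ with $\psi(j(n+1))=c_j$ for $j\in[1,m]$ and $\psi(i+(j-1)(n+1))=\chi(i)$ for $i\in[1,n]$, $j\in[1,m+1]$. -}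

module Defs where

open import Data.Nat using (ℕ; zero; suc; _+_; _*_; _∸_; _≤_; _<_; _≤?_; _≟_)
open import Data.List using (List; []; _∷_)
open import Data.Product using (_×_)
open import Data.Sum using (_⊎_)
open import Relation.Nullary using (¬_; yes; no)
open import Relation.Binary.PropositionalEquality using (_≡_; _≢_)

-- A coloring of [1,n] is represented as a function ℕ → ℕ; only its values
-- on [1,n] matter.  It is an r-coloring if every value on [1,n] lies in [1,r].
IsColoring : (r n : ℕ) → (ℕ → ℕ) → Set
IsColoring r n χ = ∀ i → 1 ≤ i → i ≤ n → (1 ≤ χ i × χ i ≤ r)

GallaiSchurTriple : (n : ℕ) → (ℕ → ℕ) → ℕ → ℕ → ℕ → Set
GallaiSchurTriple n χ x y z =
  1 ≤ x × x ≤ y × z ≤ n × x + y ≡ z ×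
  ((χ x ≡ χ y × χ y ≡ χ z) ⊎ (χ x ≢ χ y × χ y ≢ χ z × χ x ≢ χ z))

StrictGallaiSchurTriple : (n : ℕ) → (ℕ → ℕ) → ℕ → ℕ → ℕ → Set
StrictGallaiSchurTriple n χ x y z = x < y × GallaiSchurTriple n χ x y z

IsGallaiSchur : (n : ℕ) → (ℕ → ℕ) → Set
IsGallaiSchur n χ = ∀ x y z → ¬ GallaiSchurTriple n χ x y z

IsStrictGallaiSchur : (n : ℕ) → (ℕ → ℕ) → Set
IsStrictGallaiSchur n χ = ∀ x y z → ¬ StrictGallaiSchurTriple n χ x y z

IsPalindromic : (n : ℕ) → (ℕ → ℕ) → Set
IsPalindromic n χ = ∀ i → 1 ≤ i → i ≤ n → χ i ≡ χ (suc n ∸ i)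

-- Concatenation ⟨χ, c₁, χ, c₂, …, c_m, χ⟩ of a coloring χ of [1,n]:
-- positions 1..n get χ, position n+1 gets c₁, then recurse shifted by n+1.
concatColoring : (n : ℕ) → (ℕ → ℕ) → List ℕ → ℕ → ℕ
concatColoring n χ [] p = χ p
concatColoring n χ (c ∷ cs) p with p ≤? n
... | yes _ = χ p
... | no _ with p ≟ suc n
...   | yes _ = c
...   | no _ = concatColoring n χ cs (p ∸ suc n)

chiPlus : (n r : ℕ) → (ℕ → ℕ) → ℕ → ℕ
chiPlus n r χ = concatColoring n χ
  (r + 1 ∷ r + 1 ∷ r + 2 ∷ r + 1 ∷ r + 2 ∷ r + 2 ∷ r + 2 ∷ r + 1 ∷ [])

-- Write a point of [1, (m+1)(n+1) − 1] as a(n+1) + i with 0 ≤ i ≤ n: for i ≥ 1 it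
-- carries χ(i), for i = 0 the separator colour r + t_a, which lies outside the palette of χ.
-- In x + y = z the offsets add modulo n + 1.  Two separators give a strict triple of the
-- separator pattern t; a separator and a block point give colours (s, c, c); two block
-- points give a triple of χ if i + j ≤ n, colours (c, c, s) by palindromicity if
-- i + j = n + 1, and otherwise, again by palindromicity, the colours of the triple
-- (n + 1 − i, i + j − n − 1, j) of χ.  The pattern 1 1 2 1 2 2 2 1 has no strict
-- Gallai-Schur triple, which is checked by evaluation.

module Submission where

open import Defs
open import Data.Nat using (ℕ; zero; suc; _+_; _*_; _∸_; _≤_; _<_; _≤?_; _<?_; _≟_; z≤n; s≤s; s≤s⁻¹)
open import Data.Nat.Properties
open import Data.Nat.DivMod using (_/_; _%_; m≡m%n+[m/n]*n; m%n<n)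
open import Data.Nat.Tactic.RingSolver using (solve-∀)
open import Data.List using (List; []; _∷_; length; map)
open import Data.List.Properties using (length-map)
open import Data.Product using (_×_; _,_; proj₁; proj₂)
open import Data.Sum using (_⊎_; inj₁; inj₂)
open import Data.Empty using (⊥-elim)
open import Function using (_∘_; id)
open import Function.Definitions using (Injective)
open import Relation.Binary.Definitions using (tri<; tri≈; tri>)
open import Relation.Nullary using (¬_; Dec; yes; no)
open import Relation.Nullary.Decidable using (map′; from-yes; _×-dec_; _⊎-dec_; _→-dec_; ¬?)
open import Relation.Binary.PropositionalEquality

private
  variable
    n m a i j u v w u′ v′ w′ : ℕ
    χ : ℕ → ℕ

MonoOrRainbow : ℕ → ℕ → ℕ → Set
MonoOrRainbow u v w = (u ≡ v × v ≡ w) ⊎ (u ≢ v × v ≢ w × u ≢ w)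

MonoOrRainbow? : ∀ u v w → Dec (MonoOrRainbow u v w)
MonoOrRainbow? u v w =
  (u ≟ v ×-dec v ≟ w) ⊎-dec (¬? (u ≟ v) ×-dec ¬? (v ≟ w) ×-dec ¬? (u ≟ w))

MonoOrRainbow-resp : u ≡ u′ → v ≡ v′ → w ≡ w′ → MonoOrRainbow u v w → MonoOrRainbow u′ v′ w′
MonoOrRainbow-resp refl refl refl = id

MonoOrRainbow-swap₁₂ : MonoOrRainbow u v w → MonoOrRainbow v u w
MonoOrRainbow-swap₁₂ (inj₁ (u≡v , v≡w))       = inj₁ (sym u≡v , trans u≡v v≡w)
MonoOrRainbow-swap₁₂ (inj₂ (u≢v , v≢w , u≢w)) = inj₂ (u≢v ∘ sym , u≢w , v≢w)

MonoOrRainbow-swap₂₃ : MonoOrRainbow u v w → MonoOrRainbow u w v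
MonoOrRainbow-swap₂₃ (inj₁ (u≡v , v≡w))       = inj₁ (trans u≡v v≡w , sym v≡w)
MonoOrRainbow-swap₂₃ (inj₂ (u≢v , v≢w , u≢w)) = inj₂ (u≢w , v≢w ∘ sym , u≢v)

MonoOrRainbow-≡₂₃ : v ≡ w → MonoOrRainbow u v w → u ≡ v
MonoOrRainbow-≡₂₃ _   (inj₁ (u≡v , _))     = u≡v
MonoOrRainbow-≡₂₃ v≡w (inj₂ (_ , v≢w , _)) = ⊥-elim (v≢w v≡w)

MonoOrRainbow-≡₁₂ : u ≡ v → MonoOrRainbow u v w → w ≡ u
MonoOrRainbow-≡₁₂ u≡v = MonoOrRainbow-≡₂₃ u≡v ∘ MonoOrRainbow-swap₁₂ ∘ MonoOrRainbow-swap₂₃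

MonoOrRainbow-injective : ∀ {f : ℕ → ℕ} → Injective _≡_ _≡_ f →
  MonoOrRainbow (f u) (f v) (f w) → MonoOrRainbow u v w
MonoOrRainbow-injective f-inj (inj₁ (e₁ , e₂)) = inj₁ (f-inj e₁ , f-inj e₂)
MonoOrRainbow-injective {f = f} _ (inj₂ (n₁ , n₂ , n₃)) = inj₂ (n₁ ∘ cong f , n₂ ∘ cong f , n₃ ∘ cong f)

isColoring? : ∀ r n χ → Dec (IsColoring r n χ)
isColoring? r n χ = map′ (λ h i 1≤i i≤n → h (s≤s i≤n) 1≤i i≤n) (λ h {i} _ → h i)
  (allUpTo? (λ i → 1 ≤? i →-dec i ≤? n →-dec 1 ≤? χ i ×-dec χ i ≤? r) (suc n))

isStrictGallaiSchur? : ∀ n χ → Dec (IsStrictGallaiSchur n χ)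
isStrictGallaiSchur? n χ = map′ sound (λ h {x} _ {y} _ → h x y (x + y))
  (allUpTo? (λ x → allUpTo? (λ y → ¬? (triple? x y)) (suc n)) (suc n))
  where
  triple? : ∀ x y → Dec (StrictGallaiSchurTriple n χ x y (x + y))
  triple? x y = x <? y ×-dec 1 ≤? x ×-dec x ≤? y ×-dec x + y ≤? n ×-dec x + y ≟ x + y
    ×-dec MonoOrRainbow? (χ x) (χ y) (χ (x + y))
  sound : (∀ {x} → x < suc n → ∀ {y} → y < suc n → ¬ StrictGallaiSchurTriple n χ x y (x + y)) →
          IsStrictGallaiSchur n χ
  sound h x y _ t@(_ , _ , _ , x+y≤n , refl , _) =
    h (s≤s (≤-trans (m≤m+n x y) x+y≤n)) (s≤s (≤-trans (m≤n+m y x) x+y≤n)) t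

gallaiSchur-sum : IsGallaiSchur n χ → 1 ≤ i → 1 ≤ j → i + j ≤ n →
  ¬ MonoOrRainbow (χ i) (χ j) (χ (i + j))
gallaiSchur-sum {i = i} {j} gs 1≤i 1≤j i+j≤n mr with ≤-total i j
... | inj₁ i≤j = gs i j (i + j) (1≤i , i≤j , i+j≤n , refl , mr)
... | inj₂ j≤i = gs j i (i + j) (1≤j , j≤i , i+j≤n , +-comm j i , MonoOrRainbow-swap₁₂ mr)

palindromic-complement : IsPalindromic n χ → 1 ≤ j → j ≤ n → i + j ≡ suc n → χ i ≡ χ j
palindromic-complement {n} {χ} {j} {i} pal 1≤j j≤n i+j≡N = sym (begin
  χ j                ≡⟨ pal j 1≤j j≤n ⟩
  χ (suc n ∸ j)      ≡⟨ cong (λ N → χ (N ∸ j)) i+j≡N ⟨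
  χ (i + j ∸ j)      ≡⟨ cong χ (m+n∸n≡m i j) ⟩
  χ i                ∎)
  where open ≡-Reasoning

-- With p = n + 1 − i, palindromicity gives χ i ≡ χ p and p + k = j, so the
-- colours of (i, j, k) are those of the triple (p, k, j) of χ, permuted.
palindromic-wrap : ∀ {k} → IsPalindromic n χ → IsGallaiSchur n χ → 1 ≤ i → i ≤ n → j ≤ n → 1 ≤ k →
  suc n + k ≡ i + j → ¬ MonoOrRainbow (χ i) (χ j) (χ k)
palindromic-wrap {n} {χ} {i} {j} {k} pal gs 1≤i i≤n j≤n 1≤k N+k≡i+j mr =
  gallaiSchur-sum gs 1≤p 1≤k (subst (_≤ n) (sym p+k≡j) j≤n)
    (MonoOrRainbow-resp (pal i 1≤i i≤n) refl (cong χ (sym p+k≡j)) (MonoOrRainbow-swap₂₃ mr))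
  where
  p = suc n ∸ i
  1≤p : 1 ≤ p
  1≤p = m<n⇒0<n∸m (s≤s i≤n)
  p+k≡j : p + k ≡ j
  p+k≡j = +-cancelʳ-≡ i (p + k) j (begin
    p + k + i    ≡⟨ +-assoc p k i ⟩
    p + (k + i)  ≡⟨ cong (p +_) (+-comm k i) ⟩
    p + (i + k)  ≡⟨ +-assoc p i k ⟨
    p + i + k    ≡⟨ cong (_+ k) (m∸n+n≡m (m≤n⇒m≤1+n i≤n)) ⟩
    suc n + k    ≡⟨ N+k≡i+j ⟩
    i + j        ≡⟨ +-comm i j ⟩
    j + i        ∎)
    where open ≡-Reasoning

-- 1-based; junk value 0 outside [1, length cs].
listColoring : List ℕ → ℕ → ℕ
listColoring (c ∷ _)  1             = c
listColoring (_ ∷ cs) (suc (suc a)) = listColoring cs (suc a)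
listColoring _        _             = 0

listColoring-map : ∀ f cs {a} → 1 ≤ a → a ≤ length cs → listColoring (map f cs) a ≡ f (listColoring cs a)
listColoring-map f (c ∷ cs) {1}           _ _         = refl
listColoring-map f (c ∷ cs) {suc (suc a)} _ (s≤s a≤m) = listColoring-map f cs (s≤s z≤n) a≤m

concatColoring-head : ∀ c cs → i ≤ n → concatColoring n χ (c ∷ cs) i ≡ χ i
concatColoring-head {i} {n} _ _ i≤n with i ≤? n
... | yes _   = refl
... | no  i≰n = ⊥-elim (i≰n i≤n)

concatColoring-first : ∀ c cs → concatColoring n χ (c ∷ cs) (suc n) ≡ c
concatColoring-first {n} _ _ with suc n ≤? n
... | yes N≤n = ⊥-elim (1+n≰n N≤n)
... | no _ with suc n ≟ suc n
...   | yes _   = refl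
...   | no N≢N = ⊥-elim (N≢N refl)

concatColoring-tail : ∀ c cs → 1 ≤ i → concatColoring n χ (c ∷ cs) (suc n + i) ≡ concatColoring n χ cs i
concatColoring-tail {i} {n} {χ = χ} _ cs 1≤i with suc n + i ≤? n
... | yes N+i≤n = ⊥-elim (1+n≰n (≤-trans (m≤m+n (suc n) i) N+i≤n))
... | no _ with suc n + i ≟ suc n
...   | yes N+i≡N = ⊥-elim (<⇒≢ (m<m+n (suc n) 1≤i) (sym N+i≡N))
...   | no _      = cong (concatColoring n χ cs) (m+n∸m≡n (suc n) i)

concatColoring-block : ∀ cs a → 1 ≤ i → i ≤ n → a ≤ length cs →
  concatColoring n χ cs (a * suc n + i) ≡ χ i
concatColoring-block []       zero    _   _   _         = refl
concatColoring-block (c ∷ cs) zero    _   i≤n _         = concatColoring-head c cs i≤n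
concatColoring-block {i} {n} {χ} (c ∷ cs) (suc a) 1≤i i≤n (s≤s a≤m) = begin
  concatColoring n χ (c ∷ cs) (suc n + a * suc n + i)   ≡⟨ cong (concatColoring n χ (c ∷ cs)) (+-assoc (suc n) (a * suc n) i) ⟩
  concatColoring n χ (c ∷ cs) (suc n + (a * suc n + i)) ≡⟨ concatColoring-tail {n = n} {χ = χ} c cs (≤-trans 1≤i (m≤n+m i _)) ⟩
  concatColoring n χ cs (a * suc n + i)                 ≡⟨ concatColoring-block cs a 1≤i i≤n a≤m ⟩
  χ i                                                   ∎
  where open ≡-Reasoning

concatColoring-separator : ∀ cs a → 1 ≤ a → a ≤ length cs →
  concatColoring n χ cs (a * suc n) ≡ listColoring cs a
concatColoring-separator {n} {χ} (c ∷ cs) 1 _ _ rewrite +-identityʳ n = concatColoring-first {n = n} {χ = χ} c cs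
concatColoring-separator {n} {χ} (c ∷ cs) (suc (suc a)) _ (s≤s a≤m) =
  trans (concatColoring-tail {n = n} {χ = χ} c cs (s≤s z≤n)) (concatColoring-separator cs (suc a) (s≤s z≤n) a≤m)

a*n+i+[b*n+j]≡[a+b]*n+[i+j] : ∀ n a b i j → a * n + i + (b * n + j) ≡ (a + b) * n + (i + j)
a*n+i+[b*n+j]≡[a+b]*n+[i+j] = solve-∀

a*n+[b*n+j]≡[a+b]*n+j : ∀ n a b j → a * n + (b * n + j) ≡ (a + b) * n + j
a*n+[b*n+j]≡[a+b]*n+j = solve-∀

a*n+i+b*n≡[a+b]*n+i : ∀ n a b i → a * n + i + b * n ≡ (a + b) * n + i
a*n+i+b*n≡[a+b]*n+i = solve-∀

c*n+[n+k]≡[1+c]*n+k : ∀ n c k → c * n + (n + k) ≡ suc c * n + k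
c*n+[n+k]≡[1+c]*n+k = solve-∀

quotient-bound : a * suc n ≤ m * suc n + n → a ≤ m
quotient-bound {a} {n} {m} a*N≤B = s≤s⁻¹ (*-cancelʳ-< (suc n) a (suc m) (begin-strict
  a * suc n          ≤⟨ a*N≤B ⟩
  m * suc n + n      <⟨ +-monoʳ-< (m * suc n) (n<1+n n) ⟩
  m * suc n + suc n  ≡⟨ +-comm (m * suc n) (suc n) ⟩
  suc m * suc n      ∎))
  where open ≤-Reasoning

data Position (n : ℕ) : ℕ → Set where
  block     : ∀ a {i} → 1 ≤ i → i ≤ n → Position n (a * suc n + i)
  separator : ∀ a → 1 ≤ a → Position n (a * suc n)

position : ∀ n p → 1 ≤ p → Position n p
position n p 1≤p =
  subst (Position n) (sym p≡quot*N+rem) (view quot rem (s≤s⁻¹ (m%n<n p (suc n))) (subst (1 ≤_) p≡quot*N+rem 1≤p))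
  where
  quot = p / suc n
  rem = p % suc n
  p≡quot*N+rem : p ≡ quot * suc n + rem
  p≡quot*N+rem = trans (m≡m%n+[m/n]*n p (suc n)) (+-comm rem (quot * suc n))
  view : ∀ a i → i ≤ n → 1 ≤ a * suc n + i → Position n (a * suc n + i)
  view a       (suc i) i≤n _ = block a (s≤s z≤n) i≤n
  view zero    zero    _   ()
  view (suc a) zero    _   _ = subst (Position n) (sym (+-identityʳ _)) (separator (suc a) (s≤s z≤n))

module ShiftedConcatenation
  {n r s : ℕ} {χ : ℕ → ℕ} (ts : List ℕ)
  (χ-coloring : IsColoring r n χ) (χ-palindromic : IsPalindromic n χ) (χ-gallaiSchur : IsGallaiSchur n χ)
  (ts-coloring : IsColoring s (length ts) (listColoring ts))
  (ts-strict : IsStrictGallaiSchur (length ts) (listColoring ts))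
  where

  private
    N = suc n
    B = length ts * N + n

  ψ : ℕ → ℕ
  ψ = concatColoring n χ (map (r +_) ts)

  separator-index-bound : ∀ {p} a → p ≡ a * N → p ≤ B → a ≤ length ts
  separator-index-bound a refl = quotient-bound

  ψ-block : ∀ {p} a {i} → p ≡ a * N + i → 1 ≤ i → i ≤ n → p ≤ B → ψ p ≡ χ i
  ψ-block a {i} refl 1≤i i≤n p≤B = concatColoring-block (map (r +_) ts) a 1≤i i≤n
    (subst (a ≤_) (sym (length-map (r +_) ts)) (quotient-bound (≤-trans (m≤m+n (a * N) i) p≤B)))

  ψ-separator : ∀ {p} a → p ≡ a * N → 1 ≤ a → p ≤ B → ψ p ≡ r + listColoring ts a
  ψ-separator a refl 1≤a p≤B =
    trans (concatColoring-separator (map (r +_) ts) a 1≤a (subst (a ≤_) (sym (length-map (r +_) ts)) a≤m))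
          (listColoring-map (r +_) ts 1≤a a≤m)
    where a≤m = quotient-bound p≤B

  block-colour : ∀ {p} a {i} → p ≡ a * N + i → 1 ≤ i → i ≤ n → p ≤ B → ψ p ≤ r
  block-colour a p≡ 1≤i i≤n p≤B rewrite ψ-block a p≡ 1≤i i≤n p≤B = proj₂ (χ-coloring _ 1≤i i≤n)

  separator-colour : ∀ {p} a → p ≡ a * N → 1 ≤ a → p ≤ B → r < ψ p
  separator-colour a p≡ 1≤a p≤B rewrite ψ-separator a p≡ 1≤a p≤B =
    m<m+n r (proj₁ (ts-coloring a 1≤a (separator-index-bound a p≡ p≤B)))

  coloring : IsColoring (r + s) B ψ
  coloring p 1≤p p≤B with position n p 1≤p
  ... | block a 1≤i i≤n rewrite ψ-block a refl 1≤i i≤n p≤B =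
    let 1≤χi , χi≤r = χ-coloring _ 1≤i i≤n in 1≤χi , ≤-trans χi≤r (m≤m+n r s)
  ... | separator a 1≤a rewrite ψ-separator a refl 1≤a p≤B =
    let 1≤ta , ta≤s = ts-coloring a 1≤a (separator-index-bound a refl p≤B) in
    ≤-trans 1≤ta (m≤n+m _ r) , +-monoʳ-≤ r ta≤s

  no-triple-in-blocks : ∀ a b {i j} → 1 ≤ i → i ≤ n → 1 ≤ j → j ≤ n → a * N + i + (b * N + j) ≤ B →
    ¬ MonoOrRainbow (χ i) (χ j) (ψ (a * N + i + (b * N + j)))
  no-triple-in-blocks a b {i} {j} 1≤i i≤n 1≤j j≤n z≤B mr with <-cmp (i + j) N
  ... | tri< i+j<N _ _ =
    gallaiSchur-sum χ-gallaiSchur 1≤i 1≤j i+j≤n (MonoOrRainbow-resp refl refl ψz≡χ[i+j] mr)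
    where
    i+j≤n = s≤s⁻¹ i+j<N
    ψz≡χ[i+j] = ψ-block (a + b) (a*n+i+[b*n+j]≡[a+b]*n+[i+j] N a b i j) (≤-trans 1≤i (m≤m+n i j)) i+j≤n z≤B
  ... | tri≈ _ i+j≡N _ =
    <⇒≢ (≤-<-trans (proj₂ (χ-coloring i 1≤i i≤n)) (separator-colour (suc (a + b)) z≡ (s≤s z≤n) z≤B))
      (sym (MonoOrRainbow-≡₁₂ (palindromic-complement χ-palindromic 1≤j j≤n i+j≡N) mr))
    where
    z≡ : a * N + i + (b * N + j) ≡ suc (a + b) * N
    z≡ = begin
      a * N + i + (b * N + j)  ≡⟨ a*n+i+[b*n+j]≡[a+b]*n+[i+j] N a b i j ⟩
      (a + b) * N + (i + j)    ≡⟨ cong ((a + b) * N +_) i+j≡N ⟩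
      (a + b) * N + N          ≡⟨ +-comm ((a + b) * N) N ⟩
      suc (a + b) * N          ∎
      where open ≡-Reasoning
  ... | tri> _ _ N<i+j =
    palindromic-wrap χ-palindromic χ-gallaiSchur 1≤i i≤n j≤n 1≤k N+k≡i+j
      (MonoOrRainbow-resp refl refl (ψ-block (suc (a + b)) z≡ 1≤k k≤n z≤B) mr)
    where
    k = i + j ∸ N
    N+k≡i+j : N + k ≡ i + j
    N+k≡i+j = m+[n∸m]≡n (<⇒≤ N<i+j)
    1≤k : 1 ≤ k
    1≤k = m<n⇒0<n∸m N<i+j
    k≤n : k ≤ n
    k≤n = +-cancelˡ-≤ N k n (subst (_≤ N + n) (sym N+k≡i+j) (+-mono-≤ (m≤n⇒m≤1+n i≤n) j≤n))
    z≡ : a * N + i + (b * N + j) ≡ suc (a + b) * N + k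
    z≡ = begin
      a * N + i + (b * N + j)  ≡⟨ a*n+i+[b*n+j]≡[a+b]*n+[i+j] N a b i j ⟩
      (a + b) * N + (i + j)    ≡⟨ cong ((a + b) * N +_) N+k≡i+j ⟨
      (a + b) * N + (N + k)    ≡⟨ c*n+[n+k]≡[1+c]*n+k N (a + b) k ⟩
      suc (a + b) * N + k      ∎
      where open ≡-Reasoning

  no-triple : ∀ {x y} → Position n x → Position n y → x < y → x ≤ B → y ≤ B → x + y ≤ B →
    ¬ MonoOrRainbow (ψ x) (ψ y) (ψ (x + y))
  no-triple (separator a 1≤a) (separator b 1≤b) x<y x≤B y≤B z≤B mr =
    ts-strict a b (a + b) (a<b , 1≤a , <⇒≤ a<b , separator-index-bound (a + b) z≡ z≤B , refl ,
      MonoOrRainbow-injective (+-cancelˡ-≡ r _ _) (MonoOrRainbow-resp ψx≡ ψy≡ ψz≡ mr))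
    where
    a<b = *-cancelʳ-< N a b x<y
    z≡ = sym (*-distribʳ-+ N a b)
    ψx≡ = ψ-separator a refl 1≤a x≤B
    ψy≡ = ψ-separator b refl 1≤b y≤B
    ψz≡ = ψ-separator (a + b) z≡ (≤-trans 1≤a (m≤m+n a b)) z≤B
  no-triple (separator a 1≤a) (block b 1≤j j≤n) _ x≤B y≤B z≤B mr =
    <⇒≢ (≤-<-trans (block-colour b refl 1≤j j≤n y≤B) (separator-colour a refl 1≤a x≤B))
      (sym (MonoOrRainbow-≡₂₃ (trans (ψ-block b refl 1≤j j≤n y≤B) (sym ψz≡χj)) mr))
    where ψz≡χj = ψ-block (a + b) (a*n+[b*n+j]≡[a+b]*n+j N a b _) 1≤j j≤n z≤B
  no-triple (block a 1≤i i≤n) (separator b 1≤b) _ x≤B y≤B z≤B mr =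
    <⇒≢ (≤-<-trans (block-colour a refl 1≤i i≤n x≤B) (separator-colour b refl 1≤b y≤B))
      (sym (MonoOrRainbow-≡₁₂ (trans (ψ-block a refl 1≤i i≤n x≤B) (sym ψz≡χi)) (MonoOrRainbow-swap₂₃ mr)))
    where ψz≡χi = ψ-block (a + b) (a*n+i+b*n≡[a+b]*n+i N a b _) 1≤i i≤n z≤B
  no-triple (block a 1≤i i≤n) (block b 1≤j j≤n) _ x≤B y≤B z≤B mr =
    no-triple-in-blocks a b 1≤i i≤n 1≤j j≤n z≤B
      (MonoOrRainbow-resp (ψ-block a refl 1≤i i≤n x≤B) (ψ-block b refl 1≤j j≤n y≤B) refl mr)

  strict : IsStrictGallaiSchur B ψ
  strict x y _ (x<y , 1≤x , x≤y , x+y≤B , refl , mr) =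
    no-triple (position n x 1≤x) (position n y (≤-trans 1≤x x≤y)) x<y
      (≤-trans (m≤m+n x y) x+y≤B) (≤-trans (m≤n+m y x) x+y≤B) x+y≤B mr

separatorPattern : List ℕ
separatorPattern = 1 ∷ 1 ∷ 2 ∷ 1 ∷ 2 ∷ 2 ∷ 2 ∷ 1 ∷ []

separatorPattern-coloring : IsColoring 2 8 (listColoring separatorPattern)
separatorPattern-coloring = from-yes (isColoring? 2 8 (listColoring separatorPattern))

separatorPattern-strict : IsStrictGallaiSchur 8 (listColoring separatorPattern)
separatorPattern-strict = from-yes (isStrictGallaiSchur? 8 (listColoring separatorPattern))

9*n+8≡8*[1+n]+n : ∀ n → 9 * n + 8 ≡ 8 * suc n + n
9*n+8≡8*[1+n]+n = solve-∀

theorem2p4 : (n r : ℕ) → 1 ≤ n → 3 ≤ r → (χ : ℕ → ℕ) →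
    IsColoring r n χ → IsPalindromic n χ → IsGallaiSchur n χ →
    IsColoring (r + 2) (9 * n + 8) (chiPlus n r χ) ×
    IsStrictGallaiSchur (9 * n + 8) (chiPlus n r χ)
theorem2p4 n r _ _ χ χ-coloring χ-palindromic χ-gallaiSchur =
  subst (λ B → IsColoring (r + 2) B ψ × IsStrictGallaiSchur B ψ) (sym (9*n+8≡8*[1+n]+n n))
    (coloring , strict)
  where
  open ShiftedConcatenation separatorPattern χ-coloring χ-palindromic χ-gallaiSchur
    separatorPattern-coloring separatorPattern-strict
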